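{- Let $n\ge2$, let $\mathrm{St}_n$ be the star graph with root $v_0$, let $1\le r\le n$ and let $L$ be a labeling of $\mathrm{St}_n$ with $L(v_0)=r$. Let $\kappa$ be a proper coloring with $\kappa(v_0)=i$, and let $\alpha=(\alpha_1,\dots,\alpha_\ell)$ with $\alpha_j=\#\kappa^{ -1}(j)$, where $\ell$ is the largest color used. Then $$\mathrm{asc}^L(\kappa)=|n-r-L_{\alpha_i}|+2j\quad\text{for some integer } j \text{ with } 0\le j\le\min\{L^{n-r}_{\alpha_i},R^{r-1}_{\alpha_i}\}.$$
   Context: The star graph $\mathrm{St}_n$ has $n$ vertices, a root $v_0$, and edges exactly $\{v_0,v\}$ for $v\neq v_0$. A labeling is a bijection $L:V\to\{1,\dots,n\}$; a proper coloring is $\kappa:V\to\mathbb{Z}_{>0}$ with adjacent vertices colored differently; $\mathrm{asc}^L(\kappa)$ is the number of edges $\{u,v\}$ with $L(u)<L(v)$ and $\kappa(u)<\kappa(v)$. Notation: $L_{\alpha_i}=\alpha_1+\dots+\alpha_{i-1}$ ($=0$ if $i=1$), $R_{\alpha_i}=\alpha_{i+1}+\dots+\alpha_\ell$ ($=0$ if $i=\ell$), $L^m_{\alpha_i}=\min\{m,L_{\alpha_i}\}$, $R^m_{\alpha_i}=\min\{m,R_{\alpha_i}\}$. -}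

module Defs where

open import Data.Nat using (ℕ; zero; suc; _+_; _∸_; _<_; _≤_; _⊔_; _⊓_; _≟_)
open import Data.Nat.Properties using (_<?_)
open import Data.Fin using (Fin; toℕ)
open import Data.List using (List; length; filter; map; foldr; upTo; allFin)
open import Data.Nat.ListAction using (sum)
open import Data.Product using (_×_)
open import Data.Sum using (_⊎_)
open import Relation.Nullary using (Dec; ¬_)
open import Relation.Nullary.Decidable using (_×-dec_; _⊎-dec_; ¬?)
open import Relation.Binary.PropositionalEquality using (_≡_; _≢_)
open import Function.Bundles using (_⤖_; Bijection)
open import Data.Fin.Properties using () renaming (_≟_ to _≟F_)

count : (n : ℕ) {P : Fin n → Set} → ((v : Fin n) → Dec (P v)) → ℕ
count n P? = length (filter P? (allFin n))

-- A labeling of a graph on vertex set Fin n: a bijection V → {1,…,n}.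
-- We represent {1,…,n} by Fin n, the label of v being 1 + toℕ (L v).
Labeling : ℕ → Set
Labeling n = Fin n ⤖ Fin n

lab : {n : ℕ} → Labeling n → Fin n → ℕ
lab L v = suc (toℕ (Bijection.to L v))

StarEdge : {n : ℕ} → Fin n → Fin n → Fin n → Set
StarEdge v0 u v = (u ≡ v0 × v ≢ v0) ⊎ (v ≡ v0 × u ≢ v0)

ProperColoring : {n : ℕ} → Fin n → (Fin n → ℕ) → Set
ProperColoring {n} v0 κ =
  ((v : Fin n) → 0 < κ v) × ((u v : Fin n) → StarEdge v0 u v → κ u ≢ κ v)

IsAscentAt : {n : ℕ} → Fin n → Labeling n → (Fin n → ℕ) → Fin n → Set
IsAscentAt v0 L κ v =
  (v ≢ v0) × ((lab L v0 < lab L v × κ v0 < κ v) ⊎ (lab L v < lab L v0 × κ v < κ v0))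

isAscentAt? : {n : ℕ} (v0 : Fin n) (L : Labeling n) (κ : Fin n → ℕ) (v : Fin n)
            → Dec (IsAscentAt v0 L κ v)
isAscentAt? v0 L κ v =
  ¬? (v ≟F v0) ×-dec
    ((lab L v0 <? lab L v ×-dec κ v0 <? κ v) ⊎-dec (lab L v <? lab L v0 ×-dec κ v <? κ v0))

asc : {n : ℕ} → Fin n → Labeling n → (Fin n → ℕ) → ℕ
asc {n} v0 L κ = count n (isAscentAt? v0 L κ)

α : {n : ℕ} → (Fin n → ℕ) → ℕ → ℕ
α {n} κ j = count n (λ v → κ v ≟ j)

maxColor : {n : ℕ} → (Fin n → ℕ) → ℕ
maxColor {n} κ = foldr _⊔_ 0 (map κ (allFin n))

-- L_{α_i} = α_1 + … + α_{i-1}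
Lα : {n : ℕ} → (Fin n → ℕ) → ℕ → ℕ
Lα κ i = sum (map (λ k → α κ (suc k)) (upTo (i ∸ 1)))

-- R_{α_i} = α_{i+1} + … + α_ℓ
Rα : {n : ℕ} → (Fin n → ℕ) → ℕ → ℕ
Rα κ i = sum (map (λ k → α κ (suc i + k)) (upTo (maxColor κ ∸ i)))

{-# OPTIONS --safe #-}

-- Sort the non-root vertices of the star into a 2×2 table according to
-- whether their label and their colour lie above or below those of the
-- root (#↑↑, #↑↓, #↓↑, #↓↓; label first).  The label margins are n − r and
-- r − 1, the colour margins are L_{α_i} = #{v : κ v < i} and
-- R_{α_i} = #{v : κ v > i}, and the ascents are exactly the diagonal
-- #↑↑ + #↓↓.  For any such table the diagonal equals
-- |(#↑↑ + #↑↓) − (#↑↓ + #↓↓)| + 2 min(#↑↑, #↓↓), and min(#↑↑, #↓↓) is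
-- bounded by every margin.

module Submission where

open import Defs
open import Data.Nat using (ℕ; _+_; _*_; _∸_; _≤_; _⊓_; ∣_-_∣)
open import Data.Fin using (Fin)
open import Data.Product using (Σ; _×_)
open import Relation.Binary.PropositionalEquality using (_≡_)

open import Level using (0ℓ)
open import Function.Base using (_∘_; id)
open import Function.Bundles using (_⤖_; Bijection)
open import Function.Properties.Bijection using (⤖⇒↔)
open import Data.Bool.Base using (true; false; if_then_else_)
open import Data.Nat.Base using (zero; suc; _<_; _⊔_; s≤s; s≤s⁻¹; s<s; s<s⁻¹)
open import Data.Nat.Properties
open import Data.Nat.ListAction using (sum)
open import Data.Nat.ListAction.Properties using (sum-++)
open import Data.Fin.Base using (zero; suc; toℕ)
open import Data.Fin.Properties using (toℕ<n; toℕ-injective)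
open import Data.List.Base using (_++_; [_]; _∷ʳ_; length; filter; map; foldr; upTo; tabulate)
open import Data.List.Properties using (map-++; upTo-∷ʳ)
open import Data.List.Membership.Propositional using (_∈_)
open import Data.List.Membership.Propositional.Properties using (∈-map⁺; ∈-allFin)
open import Data.List.Relation.Unary.Any using (here; there)
open import Data.Product using (_,_; proj₁; proj₂; swap)
open import Data.Sum using (_⊎_; inj₁; inj₂)
open import Relation.Nullary using (Dec; yes; no; does; ¬_; contradiction)
open import Relation.Nullary.Decidable using (_×-dec_; _⊎-dec_; ¬?)
open import Relation.Unary using (Pred; Decidable; Empty; _∩_; ∁; _≐_; _⊥_)
open import Relation.Unary.Properties using (_∩?_; _∪?_; ∁?)
open import Relation.Binary.PropositionalEquality using (refl; sym; trans; cong; cong₂; subst; ≢-sym; _≢_; module ≡-Reasoning)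
open import Algebra.Properties.CommutativeMonoid.Sum +-0-commutativeMonoid
  using (sum-syntax; sum-cong-≗; sum-replicate-zero; ∑-distrib-+; ∑-permute)
  renaming (sum to ∑)

-- Only `does` is inspected, so χ (suc a <? suc b) computes to χ (a <? b).
χ : {P : Set} → Dec P → ℕ
χ p? = if does p? then 1 else 0

module _ {P Q : Set} where

  χ-cong : (P → Q) → (Q → P) → (p? : Dec P) (q? : Dec Q) → χ p? ≡ χ q?
  χ-cong _   _   (yes _) (yes _) = refl
  χ-cong P→Q _   (yes p) (no ¬q) = contradiction (P→Q p) ¬q
  χ-cong _   Q→P (no ¬p) (yes q) = contradiction (Q→P q) ¬p
  χ-cong _   _   (no _)  (no _)  = refl

  χ-split : (p? : Dec P) (q? : Dec Q) → χ p? ≡ χ (p? ×-dec q?) + χ (p? ×-dec ¬? q?)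
  χ-split (yes _) (yes _) = refl
  χ-split (yes _) (no _)  = refl
  χ-split (no _)  _       = refl

  χ-⊎ : ¬ (P × Q) → (p? : Dec P) (q? : Dec Q) → χ (p? ⊎-dec q?) ≡ χ p? + χ q?
  χ-⊎ disjoint (yes p) (yes q) = contradiction (p , q) disjoint
  χ-⊎ _        (yes _) (no _)  = refl
  χ-⊎ _        (no _)  _       = refl

χ-∁ : {P : Set} (p? : Dec P) → χ (¬? p?) + χ p? ≡ 1
χ-∁ (yes _) = refl
χ-∁ (no _)  = refl

∑-const-1 : ∀ m → ∑[ v < m ] 1 ≡ m
∑-const-1 zero    = refl
∑-const-1 (suc m) = cong suc (∑-const-1 m)

length-filter-tabulate : ∀ {A : Set} {P : Pred A 0ℓ} (P? : Decidable P) n (g : Fin n → A)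
  → length (filter P? (tabulate g)) ≡ ∑[ k < n ] χ (P? (g k))
length-filter-tabulate P? zero    g = refl
length-filter-tabulate P? (suc n) g with does (P? (g zero))
... | true  = cong suc (length-filter-tabulate P? n (g ∘ suc))
... | false = length-filter-tabulate P? n (g ∘ suc)

private
  variable
    n : ℕ
    P Q R S : Pred (Fin n) 0ℓ

count≡∑χ : (P? : Decidable P) → count n P? ≡ ∑[ v < n ] χ (P? v)
count≡∑χ {n} P? = length-filter-tabulate P? n id

count-cong : P ≐ Q → (P? : Decidable P) (Q? : Decidable Q) → count n P? ≡ count n Q?
count-cong {n} (P⊆Q , Q⊆P) P? Q? = begin
  count n P?              ≡⟨ count≡∑χ P? ⟩
  ∑[ v < n ] χ (P? v)     ≡⟨ sum-cong-≗ (λ v → χ-cong P⊆Q Q⊆P (P? v) (Q? v)) ⟩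
  ∑[ v < n ] χ (Q? v)     ≡⟨ count≡∑χ Q? ⟨
  count n Q?              ∎
  where open ≡-Reasoning

count-∅ : Empty P → (P? : Decidable P) → count n P? ≡ 0
count-∅ {n} ∅P P? = begin
  count n P?              ≡⟨ count≡∑χ P? ⟩
  ∑[ v < n ] χ (P? v)     ≡⟨ sum-cong-≗ (λ v → χ-cong (∅P v) (λ ()) (P? v) (no λ ())) ⟩
  ∑[ v < n ] 0            ≡⟨ sum-replicate-zero n ⟩
  0                       ∎
  where open ≡-Reasoning

count-partition : (P? : Decidable P) (Q? : Decidable Q) (R? : Decidable R) (S? : Decidable S)
  → P ∩ Q ≐ R → P ∩ ∁ Q ≐ S → count n P? ≡ count n R? + count n S?
count-partition {n} P? Q? R? S? P∩Q≐R P∩∁Q≐S = begin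
  count n P?
    ≡⟨ count≡∑χ P? ⟩
  ∑[ v < n ] χ (P? v)
    ≡⟨ sum-cong-≗ (λ v → χ-split (P? v) (Q? v)) ⟩
  ∑[ v < n ] (χ ((P? ∩? Q?) v) + χ ((P? ∩? ∁? Q?) v))
    ≡⟨ ∑-distrib-+ (χ ∘ (P? ∩? Q?)) (χ ∘ (P? ∩? ∁? Q?)) ⟩
  ∑[ v < n ] χ ((P? ∩? Q?) v) + ∑[ v < n ] χ ((P? ∩? ∁? Q?) v)
    ≡⟨ cong₂ _+_ (count≡∑χ (P? ∩? Q?)) (count≡∑χ (P? ∩? ∁? Q?)) ⟨
  count n (P? ∩? Q?) + count n (P? ∩? ∁? Q?)
    ≡⟨ cong₂ _+_ (count-cong P∩Q≐R _ R?) (count-cong P∩∁Q≐S _ S?) ⟩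
  count n R? + count n S?
    ∎
  where open ≡-Reasoning

count-∪ : P ⊥ Q → (P? : Decidable P) (Q? : Decidable Q)
  → count n (P? ∪? Q?) ≡ count n P? + count n Q?
count-∪ {n} P⊥Q P? Q? = begin
  count n (P? ∪? Q?)
    ≡⟨ count≡∑χ (P? ∪? Q?) ⟩
  ∑[ v < n ] χ ((P? ∪? Q?) v)
    ≡⟨ sum-cong-≗ (λ v → χ-⊎ P⊥Q (P? v) (Q? v)) ⟩
  ∑[ v < n ] (χ (P? v) + χ (Q? v))
    ≡⟨ ∑-distrib-+ (χ ∘ P?) (χ ∘ Q?) ⟩
  ∑[ v < n ] χ (P? v) + ∑[ v < n ] χ (Q? v)
    ≡⟨ cong₂ _+_ (count≡∑χ P?) (count≡∑χ Q?) ⟨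
  count n P? + count n Q?
    ∎
  where open ≡-Reasoning

count-∁ : (P? : Decidable P) → count n (∁? P?) ≡ n ∸ count n P?
count-∁ {n} P? = begin
  count n (∁? P?)                         ≡⟨ m+n∸n≡m (count n (∁? P?)) (count n P?) ⟨
  count n (∁? P?) + count n P? ∸ count n P? ≡⟨ cong (_∸ count n P?) complement ⟩
  n ∸ count n P?                          ∎
  where
  open ≡-Reasoning
  complement : count n (∁? P?) + count n P? ≡ n
  complement = begin
    count n (∁? P?) + count n P?                   ≡⟨ cong₂ _+_ (count≡∑χ (∁? P?)) (count≡∑χ P?) ⟩
    ∑[ v < n ] χ (¬? (P? v)) + ∑[ v < n ] χ (P? v) ≡⟨ ∑-distrib-+ (χ ∘ ∁? P?) (χ ∘ P?) ⟨
    ∑[ v < n ] (χ (¬? (P? v)) + χ (P? v))          ≡⟨ sum-cong-≗ (λ v → χ-∁ (P? v)) ⟩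
    ∑[ v < n ] 1                                   ≡⟨ ∑-const-1 n ⟩
    n                                              ∎

count-permute : (π : Fin n ⤖ Fin n) (P? : Decidable P)
  → count n (P? ∘ Bijection.to π) ≡ count n P?
count-permute {n} π P? = begin
  count n (P? ∘ Bijection.to π)             ≡⟨ count≡∑χ (P? ∘ Bijection.to π) ⟩
  ∑[ v < n ] χ (P? (Bijection.to π v))      ≡⟨ ∑-permute (χ ∘ P?) (⤖⇒↔ π) ⟨
  ∑[ v < n ] χ (P? v)                       ≡⟨ count≡∑χ P? ⟨
  count n P?                                ∎
  where open ≡-Reasoning

toℕ<? : (m : ℕ) → Decidable (λ (u : Fin n) → toℕ u < m)
toℕ<? m u = toℕ u <? m

count-toℕ< : ∀ {m} → m ≤ n → count n (toℕ<? m) ≡ m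
count-toℕ< {n} {m} m≤n = trans (count≡∑χ (toℕ<? {n} m)) (∑-toℕ< m≤n)
  where
  ∑-toℕ< : ∀ {n m} → m ≤ n → ∑[ u < n ] χ (toℕ<? m u) ≡ m
  ∑-toℕ< {n} {zero}      _         = sum-replicate-zero n
  ∑-toℕ< {suc n} {suc m} (s≤s m≤n) = cong suc (∑-toℕ< m≤n)

module _ (L : Labeling n) (w : Fin n) where

  rank : ℕ
  rank = toℕ (Bijection.to L w)

  labels-below : count n (λ v → lab L v <? lab L w) ≡ lab L w ∸ 1
  labels-below = begin
    count n (λ v → lab L v <? lab L w)        ≡⟨ count-cong (s<s⁻¹ , s<s) (λ v → lab L v <? lab L w) _ ⟩
    count n (toℕ<? rank ∘ Bijection.to L)     ≡⟨ count-permute L (toℕ<? rank) ⟩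
    count n (toℕ<? rank)                      ≡⟨ count-toℕ< (<⇒≤ (toℕ<n (Bijection.to L w))) ⟩
    rank                                      ∎
    where open ≡-Reasoning

  labels-above : count n (λ v → lab L w <? lab L v) ≡ n ∸ lab L w
  labels-above = begin
    count n (λ v → lab L w <? lab L v)
      ≡⟨ count-cong (<⇒≱ , ≮⇒>) (λ v → lab L w <? lab L v) _ ⟩
    count n (∁? (toℕ<? (lab L w)) ∘ Bijection.to L)
      ≡⟨ count-permute L (∁? (toℕ<? (lab L w))) ⟩
    count n (∁? (toℕ<? (lab L w)))
      ≡⟨ count-∁ (toℕ<? {n} (lab L w)) ⟩
    n ∸ count n (toℕ<? (lab L w))
      ≡⟨ cong (n ∸_) (count-toℕ< (toℕ<n (Bijection.to L w))) ⟩
    n ∸ lab L w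
      ∎
    where
    open ≡-Reasoning
    ≮⇒> : ∀ {a b} → ¬ a < suc b → suc b < suc a
    ≮⇒> a≮1+b = s<s (≮⇒≥ a≮1+b)

≤-foldr-⊔ : ∀ {x xs} → x ∈ xs → x ≤ foldr _⊔_ 0 xs
≤-foldr-⊔ (here refl) = m≤m⊔n _ _
≤-foldr-⊔ (there x∈xs) = ≤-trans (≤-foldr-⊔ x∈xs) (m≤n⊔m _ _)

≤-maxColor : (κ : Fin n → ℕ) (v : Fin n) → κ v ≤ maxColor κ
≤-maxColor κ v = ≤-foldr-⊔ (∈-map⁺ κ (∈-allFin v))

module _ (κ : Fin n → ℕ) (s : ℕ) where

  inRange? : (m : ℕ) → Decidable (λ v → s ≤ κ v × κ v < s + m)
  inRange? m v = s ≤? κ v ×-dec κ v <? s + m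

  count-colourRange : ∀ m
    → sum (map (λ k → count n (λ v → κ v ≟ s + k)) (upTo m)) ≡ count n (inRange? m)
  count-colourRange zero = sym (count-∅ empty (inRange? 0))
    where
    empty : Empty (λ v → s ≤ κ v × κ v < s + 0)
    empty v (s≤c , c<s+0) = <-irrefl refl (≤-<-trans s≤c (subst (κ v <_) (+-identityʳ s) c<s+0))
  count-colourRange (suc m) = begin
    sum (map colourClass (upTo (suc m)))
      ≡⟨ cong (sum ∘ map colourClass) (upTo-∷ʳ m) ⟨
    sum (map colourClass (upTo m ∷ʳ m))
      ≡⟨ cong sum (map-++ colourClass (upTo m) [ m ]) ⟩
    sum (map colourClass (upTo m) ++ [ colourClass m ])
      ≡⟨ sum-++ (map colourClass (upTo m)) [ colourClass m ] ⟩
    sum (map colourClass (upTo m)) + (colourClass m + 0)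
      ≡⟨ cong₂ _+_ (count-colourRange m) (+-identityʳ (colourClass m)) ⟩
    count n (inRange? m) + colourClass m
      ≡⟨ count-∪ disjoint (inRange? m) (λ v → κ v ≟ s + m) ⟨
    count n (inRange? m ∪? λ v → κ v ≟ s + m)
      ≡⟨ count-cong (extend , split) _ (inRange? (suc m)) ⟩
    count n (inRange? (suc m))
      ∎
    where
    open ≡-Reasoning
    colourClass : ℕ → ℕ
    colourClass k = count n (λ v → κ v ≟ s + k)
    disjoint : ∀ {v} → ¬ ((s ≤ κ v × κ v < s + m) × κ v ≡ s + m)
    disjoint ((_ , c<s+m) , c≡s+m) = <-irrefl c≡s+m c<s+m
    extend : ∀ {c} → (s ≤ c × c < s + m) ⊎ c ≡ s + m → s ≤ c × c < s + suc m
    extend (inj₁ (s≤c , c<s+m)) = s≤c , <-trans c<s+m (+-monoʳ-< s (n<1+n m))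
    extend (inj₂ refl)          = m≤m+n s m , +-monoʳ-< s (n<1+n m)
    split : ∀ {c} → s ≤ c × c < s + suc m → (s ≤ c × c < s + m) ⊎ c ≡ s + m
    split {c} (s≤c , c<s+1+m) with m≤n⇒m<n∨m≡n (s≤s⁻¹ (subst (c <_) (+-suc s m) c<s+1+m))
    ... | inj₁ c<s+m = inj₁ (s≤c , c<s+m)
    ... | inj₂ c≡s+m = inj₂ c≡s+m

Lα≡count< : (κ : Fin n → ℕ) → (∀ v → 0 < κ v) → ∀ i → Lα κ i ≡ count n (λ v → κ v <? i)
Lα≡count< κ _ zero =
  sym (count-∅ (λ _ ()) (λ v → κ v <? 0))
Lα≡count< κ positive (suc i) =
  trans (count-colourRange κ 1 i) (count-cong (proj₂ , λ {v} c<i → positive v , c<i) (inRange? κ 1 i) _)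

Rα≡count> : (κ : Fin n → ℕ) → ∀ i → Rα κ i ≡ count n (λ v → i <? κ v)
Rα≡count> κ i =
  trans (count-colourRange κ (suc i) (maxColor κ ∸ i)) (count-cong (proj₁ , λ {v} i<c → i<c , below-max v) (inRange? κ (suc i) _) _)
  where
  below-max : ∀ v → κ v < suc i + (maxColor κ ∸ i)
  below-max v = s≤s (≤-trans (≤-maxColor κ v) (m≤n+m∸n (maxColor κ) i))

≢∧≮⇒> : ∀ {a b} → a ≢ b → ¬ a < b → b < a
≢∧≮⇒> a≢b a≮b = ≤∧≢⇒< (≮⇒≥ a≮b) (≢-sym a≢b)

module StarQuadrants (v0 : Fin n) (L : Labeling n) (κ : Fin n → ℕ) (proper : ProperColoring v0 κ) where

  LabelAbove LabelBelow ColourAbove ColourBelow : Pred (Fin n) 0ℓ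
  LabelAbove  v = lab L v0 < lab L v
  LabelBelow  v = lab L v < lab L v0
  ColourAbove v = κ v0 < κ v
  ColourBelow v = κ v < κ v0

  labelAbove? : Decidable LabelAbove
  labelAbove? v = lab L v0 <? lab L v

  labelBelow? : Decidable LabelBelow
  labelBelow? v = lab L v <? lab L v0

  colourAbove? : Decidable ColourAbove
  colourAbove? v = κ v0 <? κ v

  colourBelow? : Decidable ColourBelow
  colourBelow? v = κ v <? κ v0

  #↑↑ #↑↓ #↓↑ #↓↓ : ℕ
  #↑↑ = count n (labelAbove? ∩? colourAbove?)
  #↑↓ = count n (labelAbove? ∩? colourBelow?)
  #↓↑ = count n (labelBelow? ∩? colourAbove?)
  #↓↓ = count n (labelBelow? ∩? colourBelow?)

  off-root : (f : Fin n → ℕ) {v : Fin n} → f v0 < f v ⊎ f v < f v0 → v ≢ v0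
  off-root f (inj₁ f0<fv) refl = <-irrefl refl f0<fv
  off-root f (inj₂ fv<f0) refl = <-irrefl refl fv<f0

  label≢ : ∀ {v} → v ≢ v0 → lab L v0 ≢ lab L v
  label≢ v≢v0 eq = v≢v0 (Bijection.injective L (toℕ-injective (suc-injective (sym eq))))

  colour≢ : ∀ {v} → v ≢ v0 → κ v0 ≢ κ v
  colour≢ v≢v0 = proj₂ proper v0 _ (inj₁ (refl , v≢v0))

  count-labelAbove : count n labelAbove? ≡ #↑↑ + #↑↓
  count-labelAbove = count-partition labelAbove? colourAbove? _ _ (id , id)
    ( (λ (a , c̸) → a , ≢∧≮⇒> (colour≢ (off-root (lab L) (inj₁ a))) c̸)
    , (λ (a , d) → a , <-asym d) )

  count-labelBelow : count n labelBelow? ≡ #↓↓ + #↓↑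
  count-labelBelow = count-partition labelBelow? colourBelow? _ _ (id , id)
    ( (λ (b , d̸) → b , ≢∧≮⇒> (≢-sym (colour≢ (off-root (lab L) (inj₂ b)))) d̸)
    , (λ (b , c) → b , <-asym c) )

  count-colourAbove : count n colourAbove? ≡ #↑↑ + #↓↑
  count-colourAbove = count-partition colourAbove? labelAbove? _ _ (swap , swap)
    ( (λ (c , a̸) → ≢∧≮⇒> (label≢ (off-root κ (inj₁ c))) a̸ , c)
    , (λ (b , c) → c , <-asym b) )

  count-colourBelow : count n colourBelow? ≡ #↑↓ + #↓↓
  count-colourBelow = count-partition colourBelow? labelAbove? _ _ (swap , swap)
    ( (λ (d , a̸) → ≢∧≮⇒> (label≢ (off-root κ (inj₂ d))) a̸ , d)
    , (λ (b , d) → d , <-asym b) )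

  asc≡#↑↑+#↓↓ : asc v0 L κ ≡ #↑↑ + #↓↓
  asc≡#↑↑+#↓↓ = begin
    asc v0 L κ
      ≡⟨ count-cong (proj₂ , λ e → off-root′ e , e) (isAscentAt? v0 L κ) (↑↑? ∪? ↓↓?) ⟩
    count n (↑↑? ∪? ↓↓?)
      ≡⟨ count-∪ (λ ((a , _) , (b , _)) → <-asym a b) ↑↑? ↓↓? ⟩
    #↑↑ + #↓↓
      ∎
    where
    open ≡-Reasoning
    ↑↑? : Decidable (LabelAbove ∩ ColourAbove)
    ↑↑? = labelAbove? ∩? colourAbove?
    ↓↓? : Decidable (LabelBelow ∩ ColourBelow)
    ↓↓? = labelBelow? ∩? colourBelow?
    off-root′ : ∀ {v} → (LabelAbove v × ColourAbove v) ⊎ (LabelBelow v × ColourBelow v) → v ≢ v0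
    off-root′ (inj₁ (a , _)) = off-root (lab L) (inj₁ a)
    off-root′ (inj₂ (b , _)) = off-root (lab L) (inj₂ b)

m+n≡∣m-n∣+2*[m⊓n] : ∀ m n → m + n ≡ ∣ m - n ∣ + 2 * (m ⊓ n)
m+n≡∣m-n∣+2*[m⊓n] zero    n       = sym (+-identityʳ n)
m+n≡∣m-n∣+2*[m⊓n] (suc m) zero    = refl
m+n≡∣m-n∣+2*[m⊓n] (suc m) (suc n) = begin
  suc m + suc n                   ≡⟨ cong suc (+-suc m n) ⟩
  2 + (m + n)                     ≡⟨ cong (2 +_) (m+n≡∣m-n∣+2*[m⊓n] m n) ⟩
  2 + (∣ m - n ∣ + 2 * (m ⊓ n))   ≡⟨ +-comm 2 _ ⟩
  ∣ m - n ∣ + 2 * (m ⊓ n) + 2     ≡⟨ +-assoc ∣ m - n ∣ _ 2 ⟩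
  ∣ m - n ∣ + (2 * (m ⊓ n) + 2)   ≡⟨ cong (∣ m - n ∣ +_) (+-comm _ 2) ⟩
  ∣ m - n ∣ + (2 + 2 * (m ⊓ n))   ≡⟨ cong (∣ m - n ∣ +_) (*-suc 2 (m ⊓ n)) ⟨
  ∣ m - n ∣ + 2 * suc (m ⊓ n)     ∎
  where open ≡-Reasoning

diagonal≡∣row-col∣+2j : ∀ {A B C D E} p q x y
  → A ≡ p + x → B ≡ x + q → C ≡ q + y → D ≡ p + y → E ≡ p + q
  → Σ ℕ (λ j → (j ≤ (A ⊓ B) ⊓ (C ⊓ D)) × (E ≡ ∣ A - B ∣ + 2 * j))
diagonal≡∣row-col∣+2j p q x y refl refl refl refl refl = p ⊓ q , bound , diagonal
  where
  bound : p ⊓ q ≤ ((p + x) ⊓ (x + q)) ⊓ ((q + y) ⊓ (p + y))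
  bound = ⊓-glb (⊓-glb (≤-trans (m⊓n≤m p q) (m≤m+n p x)) (≤-trans (m⊓n≤n p q) (m≤n+m q x)))
                (⊓-glb (≤-trans (m⊓n≤n p q) (m≤m+n q y)) (≤-trans (m⊓n≤m p q) (m≤m+n p y)))
  diagonal : p + q ≡ ∣ p + x - x + q ∣ + 2 * (p ⊓ q)
  diagonal = begin
    p + q                             ≡⟨ m+n≡∣m-n∣+2*[m⊓n] p q ⟩
    ∣ p - q ∣ + 2 * (p ⊓ q)           ≡⟨ cong (_+ 2 * (p ⊓ q)) (∣m+n-m+o∣≡∣n-o∣ x p q) ⟨
    ∣ x + p - x + q ∣ + 2 * (p ⊓ q)   ≡⟨ cong (λ a → ∣ a - x + q ∣ + 2 * (p ⊓ q)) (+-comm x p) ⟩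
    ∣ p + x - x + q ∣ + 2 * (p ⊓ q)   ∎
    where open ≡-Reasoning

lemma4p1 : (n : ℕ) → 2 ≤ n → (v0 : Fin n) → (r : ℕ) → 1 ≤ r → r ≤ n
    → (L : Labeling n) → lab L v0 ≡ r
    → (κ : Fin n → ℕ) → ProperColoring v0 κ
    → (i : ℕ) → κ v0 ≡ i
    → Σ ℕ (λ j → (j ≤ ((n ∸ r) ⊓ Lα κ i) ⊓ ((r ∸ 1) ⊓ Rα κ i))
                 × (asc v0 L κ ≡ ∣ n ∸ r - Lα κ i ∣ + 2 * j))
lemma4p1 n _ v0 _ _ _ L refl κ proper _ refl =
  diagonal≡∣row-col∣+2j #↑↑ #↓↓ #↑↓ #↓↑
    (trans (sym (labels-above L v0)) count-labelAbove)
    (trans (Lα≡count< κ (proj₁ proper) (κ v0)) count-colourBelow)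
    (trans (sym (labels-below L v0)) count-labelBelow)
    (trans (Rα≡count> κ (κ v0)) count-colourAbove)
    asc≡#↑↑+#↓↓
  where open StarQuadrants v0 L κ proper
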